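{- Let $X, Y \subseteq \omega$. There exists an embedding $f : \mathcal{G}^X \hookrightarrow \mathcal{G}^Y$ that is not order-reversing if and only if $X \le_e Y$.
   Context: Scott's graph application on $\mathcal{P}(\omega)$ is $A \cdot B = \{n \mid \exists u\, (\langle n,u\rangle \in A \wedge D_u \subseteq B)\}$, $D_u$ the finite set with canonical code $u$ and $\langle\cdot,\cdot\rangle$ a bijective pairing. $\mathcal{G}^X$ is the least class of subsets of $\omega$ containing $X$ and all c.e. sets and closed under this application (equivalently, the sets enumeration-reducible to $X$); it is a pca. $Z \le_e Y$ means there is a c.e. relation $R$ with $x \in Z \iff \exists u\,(R(x,u) \wedge D_u \subseteq Y)$. An embedding is an injective map preserving application ($f(A)f(B) = f(AB)$). An embedding $f$ is order-reversing if for all $A, B \in \mathcal{G}^X$, $A \subseteq B$ implies $f(B) \subseteq f(A)$. -}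

module Defs where

open import Level using (Level)
open import Data.Nat using (ℕ; zero; suc; _+_)
open import Data.Nat.DivMod using (_/_; _%_)
open import Data.Fin using (Fin)
open import Data.Vec using (Vec; []; _∷_; lookup)
open import Data.Product using (Σ; ∃; _×_; _,_)
open import Function.Bundles using (_⇔_)
open import Relation.Binary.PropositionalEquality using (_≡_)
open import Relation.Nullary using (¬_)

Subset : Set₁
Subset = ℕ → Set

_⊆_ : Subset → Subset → Set
A ⊆ B = ∀ n → A n → B n

_≐_ : Subset → Subset → Set
A ≐ B = (A ⊆ B) × (B ⊆ A)

data PR : ℕ → Set where
  Z : ∀ {n} → PR n
  S : PR 1
  P : ∀ {n} → Fin n → PR n
  C : ∀ {m n} → PR m → Vec (PR n) m → PR n
  R : ∀ {n} → PR n → PR (suc (suc n)) → PR (suc n)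

mutual
  ⟦_⟧ : ∀ {n} → PR n → Vec ℕ n → ℕ
  ⟦ Z ⟧ xs = 0
  ⟦ S ⟧ (x ∷ []) = suc x
  ⟦ P i ⟧ xs = lookup xs i
  ⟦ C f gs ⟧ xs = ⟦ f ⟧ (evals gs xs)
  ⟦ R f g ⟧ (k ∷ xs) = evalR f g k xs

  evals : ∀ {m n} → Vec (PR n) m → Vec ℕ n → Vec ℕ m
  evals [] xs = []
  evals (g ∷ gs) xs = ⟦ g ⟧ xs ∷ evals gs xs

  evalR : ∀ {n} → PR n → PR (suc (suc n)) → ℕ → Vec ℕ n → ℕ
  evalR f g zero xs = ⟦ f ⟧ xs
  evalR f g (suc k) xs = ⟦ g ⟧ (k ∷ evalR f g k xs ∷ xs)

-- A relation on ℕ^n is c.e. iff it is the projection of a primitive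
-- recursive relation:  R(xs) ⇔ ∃ y. e(y, xs) = 0.
Halts : ∀ {n} → PR (suc n) → Vec ℕ n → Set
Halts e xs = ∃ λ y → ⟦ e ⟧ (y ∷ xs) ≡ 0

IsCE : Subset → Set
IsCE A = Σ (PR 2) λ e → ∀ n → A n ⇔ Halts e (n ∷ [])

-- Canonical finite sets D_u  (i ∈ D_u iff bit i of u is 1)

bit : ℕ → ℕ → ℕ
bit u zero = u % 2
bit u (suc i) = bit (u / 2) i

D : ℕ → Subset
D u i = bit u i ≡ 1

-- Cantor pairing  ⟨n,u⟩ = (n+u)(n+u+1)/2 + u  (a bijection ℕ×ℕ → ℕ)
tri : ℕ → ℕ
tri zero = 0
tri (suc k) = suc k + tri k

⟨_,_⟩ : ℕ → ℕ → ℕ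
⟨ n , u ⟩ = tri (n + u) + u

_·_ : Subset → Subset → Subset
(A · B) n = ∃ λ u → A ⟨ n , u ⟩ × (D u ⊆ B)

_≤e_ : Subset → Subset → Set
Zs ≤e Y = Σ (PR 3) λ e → ∀ x → Zs x ⇔ (∃ λ u → Halts e (x ∷ u ∷ []) × (D u ⊆ Y))

𝒢 : Subset → Subset → Set
𝒢 X A = A ≤e X

-- Embeddings G^X ↪ G^Y  (sets are compared extensionally)

record IsEmbedding (X Y : Subset) (f : Subset → Subset) : Set₁ where
  field
    maps     : ∀ A → 𝒢 X A → 𝒢 Y (f A)
    wellDef  : ∀ A B → 𝒢 X A → 𝒢 X B → A ≐ B → f A ≐ f B
    injective : ∀ A B → 𝒢 X A → 𝒢 X B → f A ≐ f B → A ≐ B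
    preserves : ∀ A B → 𝒢 X A → 𝒢 X B → (f A · f B) ≐ f (A · B)

OrderReversing : (X : Subset) (f : Subset → Subset) → Set₁
OrderReversing X f = ∀ A B → 𝒢 X A → 𝒢 X B → A ⊆ B → f B ⊆ f A

-- If X ≤e Y, the identity is an embedding 𝒢 X ↪ 𝒢 Y, and it does not reverse ∅ ⊆ ω.
-- Conversely, let f be an embedding that is not order-reversing. A set E with E·∅ = A and
-- E·ω = B shows that f reverses ∅ ⊆ ω only if it reverses every A ⊆ B; hence (classically)
-- some k lies in f ω but not in f ∅. For a set T with T·{n} = ω when n ∈ X and T·{n} = ∅
-- otherwise, n ∈ X ⇔ k ∈ f T · f {n}. The sets f {n} are generated from f {0} by applying
-- f (succ), so the pairs ⟨n , j⟩ with j ∈ f {n} are exactly those occurring in finite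
-- derivations, which Y can enumerate; therefore X ≤e Y.
-- Enumeration reductions are produced from formulas positive in the oracle: each reduces to
-- ∃u (ψ(u) ∧ D_u ⊆ Y) with ψ a Σ₁ formula, and each Σ₁ formula to ∃y (t(y) = 0) for a term t
-- that compiles to a primitive recursive code.

module Submission where

open import Defs
open import Data.Nat using (ℕ; zero; suc; _+_; _*_; _∸_; _<_; z≤n; s≤s; pred; _≟_)
open import Data.Nat.Properties
open import Data.Nat.DivMod using (_/_; _%_; m<n⇒m/n≡0; m*n/n≡m; [m+kn]%n≡m%n; m<n⇒m%n≡m; +-distrib-/-∣ʳ; m/n*n≤m; m%n<n)
open import Data.Nat.Divisibility using (divides-refl)
open import Data.Fin using (Fin; zero; suc; punchIn; #_)
open import Data.Vec using (Vec; []; _∷_; lookup; tabulate; insertAt)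
open import Data.Vec.Properties using (tabulate∘lookup; lookup∘tabulate; tabulate-cong; insertAt-punchIn)
open import Data.Product using (Σ; ∃; _×_; _,_; proj₁; proj₂)
open import Data.Sum using (_⊎_; inj₁; inj₂)
open import Data.Empty using (⊥; ⊥-elim)
open import Data.Unit using (⊤; tt)
open import Function using (id; _∘_; case_of_)
open import Function.Bundles using (_⇔_; mk⇔; Equivalence)
open import Function.Properties.Equivalence using () renaming (refl to ⇔-refl; sym to ⇔-sym; trans to ⇔-trans)
open import Function.Related.Propositional using (module EquationalReasoning)
open import Data.Product.Function.NonDependent.Propositional using (_×-⇔_)
open import Data.Sum.Function.Propositional using (_⊎-⇔_)
open import Relation.Binary using (tri<; tri≈; tri>)
open import Relation.Binary.PropositionalEquality
open import Relation.Nullary using (¬_; Dec; yes; no)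
open import Level using (0ℓ)
open import Axiom.ExcludedMiddle using (ExcludedMiddle)
open import Relation.Nullary.Decidable using (_⊎-dec_)

open Equivalence using (to; from)

∃-⇔ : ∀ {A B : ℕ → Set} → (∀ y → A y ⇔ B y) → ∃ A ⇔ ∃ B
∃-⇔ A⇔B = mk⇔ (λ (y , a) → y , to (A⇔B y) a) (λ (y , b) → y , from (A⇔B y) b)

∀<-⇔ : ∀ {k l} {A B : ℕ → Set} → k ≡ l → (∀ y → A y ⇔ B y) →
       (∀ y → y < k → A y) ⇔ (∀ y → y < l → B y)
∀<-⇔ refl A⇔B = mk⇔ (λ a y y<k → to (A⇔B y) (a y y<k)) (λ b y y<k → from (A⇔B y) (b y y<k))

∀-⇔ : ∀ {I : Set} {A B : I → Set} → (∀ i → A i ⇔ B i) → (∀ i → A i) ⇔ (∀ i → B i)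
∀-⇔ A⇔B = mk⇔ (λ a i → to (A⇔B i) (a i)) (λ b i → from (A⇔B i) (b i))

≡-⇔ : ∀ {a b c d : ℕ} → a ≡ c → b ≡ d → (a ≡ b) ⇔ (c ≡ d)
≡-⇔ refl refl = ⇔-refl

constᴾ : ∀ {n} → ℕ → PR n
constᴾ zero = Z
constᴾ (suc k) = C S (constᴾ k ∷ [])

constᴾ-correct : ∀ {n} k (xs : Vec ℕ n) → ⟦ constᴾ k ⟧ xs ≡ k
constᴾ-correct zero xs = refl
constᴾ-correct (suc k) xs = cong suc (constᴾ-correct k xs)

addᴾ : PR 2
addᴾ = R (P zero) (C S (P (suc zero) ∷ []))

addᴾ-correct : ∀ x y → ⟦ addᴾ ⟧ (x ∷ y ∷ []) ≡ x + y
addᴾ-correct zero y = refl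
addᴾ-correct (suc x) y = cong suc (addᴾ-correct x y)

mulᴾ : PR 2
mulᴾ = R Z (C addᴾ (P (suc zero) ∷ P (suc (suc zero)) ∷ []))

mulᴾ-correct : ∀ x y → ⟦ mulᴾ ⟧ (x ∷ y ∷ []) ≡ x * y
mulᴾ-correct zero y = refl
mulᴾ-correct (suc x) y = begin
  ⟦ addᴾ ⟧ (⟦ mulᴾ ⟧ (x ∷ y ∷ []) ∷ y ∷ []) ≡⟨ addᴾ-correct _ y ⟩
  ⟦ mulᴾ ⟧ (x ∷ y ∷ []) + y                 ≡⟨ cong (_+ y) (mulᴾ-correct x y) ⟩
  x * y + y                                 ≡⟨ +-comm (x * y) y ⟩
  suc x * y                                 ∎
  where open ≡-Reasoning

predᴾ : PR 1
predᴾ = R Z (P zero)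

predᴾ-correct : ∀ x → ⟦ predᴾ ⟧ (x ∷ []) ≡ pred x
predᴾ-correct zero = refl
predᴾ-correct (suc x) = refl

flippedMonusᴾ : PR 2
flippedMonusᴾ = R (P zero) (C predᴾ (P (suc zero) ∷ []))

flippedMonusᴾ-correct : ∀ y x → ⟦ flippedMonusᴾ ⟧ (y ∷ x ∷ []) ≡ x ∸ y
flippedMonusᴾ-correct zero x = refl
flippedMonusᴾ-correct (suc y) x = begin
  ⟦ predᴾ ⟧ (⟦ flippedMonusᴾ ⟧ (y ∷ x ∷ []) ∷ []) ≡⟨ predᴾ-correct (⟦ flippedMonusᴾ ⟧ (y ∷ x ∷ [])) ⟩
  pred (⟦ flippedMonusᴾ ⟧ (y ∷ x ∷ []))          ≡⟨ cong pred (flippedMonusᴾ-correct y x) ⟩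
  pred (x ∸ y)                                    ≡⟨ pred[m∸n]≡m∸[1+n] x y ⟩
  x ∸ suc y                                       ∎
  where open ≡-Reasoning

monusᴾ : PR 2
monusᴾ = C flippedMonusᴾ (P (suc zero) ∷ P zero ∷ [])

monusᴾ-correct : ∀ x y → ⟦ monusᴾ ⟧ (x ∷ y ∷ []) ≡ x ∸ y
monusᴾ-correct x y = flippedMonusᴾ-correct y x

evals-tabulate : ∀ {m n} (g : Fin m → PR n) xs → evals (tabulate g) xs ≡ tabulate (λ i → ⟦ g i ⟧ xs)
evals-tabulate {zero} g xs = refl
evals-tabulate {suc m} g xs = cong (⟦ g zero ⟧ xs ∷_) (evals-tabulate (g ∘ suc) xs)

projections : ∀ {n} → Vec (PR n) n
projections = tabulate P

projections-correct : ∀ {n} (xs : Vec ℕ n) → evals projections xs ≡ xs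
projections-correct xs = trans (evals-tabulate P xs) (tabulate∘lookup xs)

dropTwo : ∀ {n} → Vec (PR (suc (suc n))) n
dropTwo = tabulate (λ i → P (suc (suc i)))

dropTwo-correct : ∀ {n} y z (xs : Vec ℕ n) → evals dropTwo (y ∷ z ∷ xs) ≡ xs
dropTwo-correct y z xs = trans (evals-tabulate (λ i → P (suc (suc i))) (y ∷ z ∷ xs)) (tabulate∘lookup xs)

sumBelow : ℕ → (ℕ → ℕ) → ℕ
sumBelow zero f = 0
sumBelow (suc k) f = sumBelow k f + f k

productBelow : ℕ → (ℕ → ℕ) → ℕ
productBelow zero f = 1
productBelow (suc k) f = productBelow k f * f k

distance≡0⇔≡ : ∀ a b → (a ∸ b + (b ∸ a) ≡ 0) ⇔ (a ≡ b)
distance≡0⇔≡ a b = mk⇔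
  (λ d≡0 → ≤-antisym (m∸n≡0⇒m≤n (m+n≡0⇒m≡0 (a ∸ b) d≡0)) (m∸n≡0⇒m≤n (m+n≡0⇒n≡0 (a ∸ b) d≡0)))
  (λ { refl → cong₂ _+_ (n∸n≡0 a) (n∸n≡0 a) })

*≡0⇔ : ∀ m n → (m * n ≡ 0) ⇔ (m ≡ 0 ⊎ n ≡ 0)
*≡0⇔ m n = mk⇔ (m*n≡0⇒m≡0∨n≡0 m) λ { (inj₁ refl) → refl ; (inj₂ refl) → *-zeroʳ m }

productBelow≡0⇔ : ∀ k (f : ℕ → ℕ) → (productBelow k f ≡ 0) ⇔ (∃ λ y → y < k × f y ≡ 0)
productBelow≡0⇔ zero f = mk⇔ (λ ()) (λ ())
productBelow≡0⇔ (suc k) f = mk⇔ sound complete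
  where
  sound : productBelow (suc k) f ≡ 0 → ∃ λ y → y < suc k × f y ≡ 0
  sound p≡0 with to (*≡0⇔ (productBelow k f) (f k)) p≡0
  ... | inj₁ pk≡0 = let (y , y<k , fy≡0) = to (productBelow≡0⇔ k f) pk≡0 in y , m<n⇒m<1+n y<k , fy≡0
  ... | inj₂ fk≡0 = k , ≤-refl , fk≡0
  complete : (∃ λ y → y < suc k × f y ≡ 0) → productBelow (suc k) f ≡ 0
  complete (y , y<1+k , fy≡0) = from (*≡0⇔ (productBelow k f) (f k)) (case m<1+n⇒m<n∨m≡n y<1+k of λ
    { (inj₁ y<k) → inj₁ (from (productBelow≡0⇔ k f) (y , y<k , fy≡0))
    ; (inj₂ refl) → inj₂ fy≡0 })

sumBelow≡0⇔ : ∀ k (f : ℕ → ℕ) → (sumBelow k f ≡ 0) ⇔ (∀ y → y < k → f y ≡ 0)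
sumBelow≡0⇔ zero f = mk⇔ (λ _ _ ()) (λ _ → refl)
sumBelow≡0⇔ (suc k) f = mk⇔
  (λ s≡0 y y<1+k → case m<1+n⇒m<n∨m≡n y<1+k of λ
    { (inj₁ y<k) → to (sumBelow≡0⇔ k f) (m+n≡0⇒m≡0 (sumBelow k f) s≡0) y y<k
    ; (inj₂ refl) → m+n≡0⇒n≡0 (sumBelow k f) s≡0 })
  (λ all≡0 → cong₂ _+_ (from (sumBelow≡0⇔ k f) (λ y y<k → all≡0 y (m<n⇒m<1+n y<k))) (all≡0 k ≤-refl))

collect-bound : ∀ k (Q : ℕ → ℕ → Set) → (∀ i → i < k → ∃ (Q i)) → ∃ λ M → ∀ i → i < k → ∃ λ y → y < M × Q i y
collect-bound zero Q witness = 0 , λ i ()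
collect-bound (suc k) Q witness =
  let (M , below-M) = collect-bound k Q (λ i i<k → witness i (m<n⇒m<1+n i<k))
      (y , Qky) = witness k ≤-refl
  in suc (M + y) , λ i i<1+k → case m<1+n⇒m<n∨m≡n i<1+k of λ
    { (inj₁ i<k) → let (y′ , y′<M , Qiy′) = below-M i i<k in y′ , ≤-trans y′<M (m≤n⇒m≤1+n (m≤m+n M y)) , Qiy′
    ; (inj₂ refl) → y , s≤s (m≤n+m y M) , Qky }

sumᴾ : ∀ {n} → PR (suc n) → PR (suc n)
sumᴾ e = R Z (C addᴾ (P (suc zero) ∷ C e (P zero ∷ dropTwo) ∷ []))

sumᴾ-correct : ∀ {n} (e : PR (suc n)) k xs → ⟦ sumᴾ e ⟧ (k ∷ xs) ≡ sumBelow k (λ y → ⟦ e ⟧ (y ∷ xs))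
sumᴾ-correct e zero xs = refl
sumᴾ-correct e (suc k) xs = trans (addᴾ-correct (⟦ sumᴾ e ⟧ (k ∷ xs)) _)
  (cong₂ _+_ (sumᴾ-correct e k xs) (cong (λ v → ⟦ e ⟧ (k ∷ v)) (dropTwo-correct k _ xs)))

productᴾ : ∀ {n} → PR (suc n) → PR (suc n)
productᴾ e = R (constᴾ 1) (C mulᴾ (P (suc zero) ∷ C e (P zero ∷ dropTwo) ∷ []))

productᴾ-correct : ∀ {n} (e : PR (suc n)) k xs → ⟦ productᴾ e ⟧ (k ∷ xs) ≡ productBelow k (λ y → ⟦ e ⟧ (y ∷ xs))
productᴾ-correct e zero xs = refl
productᴾ-correct e (suc k) xs = trans (mulᴾ-correct (⟦ productᴾ e ⟧ (k ∷ xs)) _)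
  (cong₂ _*_ (productᴾ-correct e k xs) (cong (λ v → ⟦ e ⟧ (k ∷ v)) (dropTwo-correct k _ xs)))

bit-zero-digit : ∀ {b} w → b < 2 → bit (b + w * 2) 0 ≡ b
bit-zero-digit {b} w b<2 = trans ([m+kn]%n≡m%n b w 2) (m<n⇒m%n≡m b<2)

half-digit : ∀ {b} w → b < 2 → (b + w * 2) / 2 ≡ w
half-digit {b} w b<2 = begin
  (b + w * 2) / 2   ≡⟨ +-distrib-/-∣ʳ b (divides-refl w) ⟩
  b / 2 + w * 2 / 2 ≡⟨ cong₂ _+_ (m<n⇒m/n≡0 b<2) (m*n/n≡m w 2) ⟩
  w                 ∎
  where open ≡-Reasoning

bit-suc-digit : ∀ {b} w j → b < 2 → bit (b + w * 2) (suc j) ≡ bit w j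
bit-suc-digit w j b<2 = cong (λ v → bit v j) (half-digit w b<2)

bits-of-zero : ∀ i → bit 0 i ≡ 0
bits-of-zero zero = refl
bits-of-zero (suc i) = bits-of-zero i

bit-binary : ∀ u i → bit u i ≡ 0 ⊎ bit u i ≡ 1
bit-binary u zero with u % 2 | m%n<n u 2
... | 0 | _ = inj₁ refl
... | 1 | _ = inj₂ refl
... | suc (suc _) | s≤s (s≤s ())
bit-binary u (suc i) = bit-binary (u / 2) i

0≢1 : ¬ 0 ≡ 1
0≢1 ()

D-0-empty : ∀ i → ¬ D 0 i
D-0-empty i e with trans (sym (bits-of-zero i)) e
... | ()

D-bounded : ∀ u i → D u i → i < u
D-bounded u zero e with u
... | zero = ⊥-elim (D-0-empty 0 e)
... | suc _ = s≤s z≤n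
D-bounded u (suc i) e = begin-strict
  suc i             <⟨ m<m+n (suc i) (s≤s z≤n) ⟩
  2 * suc i         ≡⟨ *-comm 2 (suc i) ⟩
  suc i * 2         ≤⟨ *-monoˡ-≤ 2 (D-bounded (u / 2) i e) ⟩
  u / 2 * 2         ≤⟨ m/n*n≤m u 2 ⟩
  u                 ∎
  where open ≤-Reasoning

parity : ℕ → ℕ
parity zero = 0
parity (suc k) = 1 ∸ parity k

half : ℕ → ℕ
half zero = 0
half (suc k) = half k + parity k

parity<2 : ∀ k → parity k < 2
parity<2 zero = s≤s z≤n
parity<2 (suc k) with parity k | parity<2 k
... | 0 | _ = s≤s (s≤s z≤n)
... | 1 | _ = s≤s z≤n
... | suc (suc _) | s≤s (s≤s ())

parity+half*2 : ∀ k → parity k + half k * 2 ≡ k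
parity+half*2 zero = refl
parity+half*2 (suc k) with parity k | parity<2 k | parity+half*2 k
... | 0 | _ | eq = cong suc (trans (cong (_* 2) (+-identityʳ (half k))) eq)
... | 1 | _ | eq = begin
  (half k + 1) * 2   ≡⟨ *-distribʳ-+ 2 (half k) 1 ⟩
  half k * 2 + 2     ≡⟨ +-comm (half k * 2) 2 ⟩
  suc (suc (half k * 2)) ≡⟨ cong suc eq ⟩
  suc k              ∎
  where open ≡-Reasoning
... | suc (suc _) | s≤s (s≤s ()) | _

lowest-bit≡parity : ∀ u → bit u 0 ≡ parity u
lowest-bit≡parity u = trans (cong (λ v → bit v 0) (sym (parity+half*2 u))) (bit-zero-digit (half u) (parity<2 u))

/2≡half : ∀ u → u / 2 ≡ half u
/2≡half u = trans (cong (_/ 2) (sym (parity+half*2 u))) (half-digit (half u) (parity<2 u))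

halvings : ℕ → ℕ → ℕ
halvings zero u = u
halvings (suc i) u = half (halvings i u)

halvings-half : ∀ i u → halvings i (half u) ≡ half (halvings i u)
halvings-half zero u = refl
halvings-half (suc i) u = cong half (halvings-half i u)

bit≡parity∘halvings : ∀ u i → bit u i ≡ parity (halvings i u)
bit≡parity∘halvings u zero = lowest-bit≡parity u
bit≡parity∘halvings u (suc i) = begin
  bit (u / 2) i                 ≡⟨ cong (λ v → bit v i) (/2≡half u) ⟩
  bit (half u) i                ≡⟨ bit≡parity∘halvings (half u) i ⟩
  parity (halvings i (half u))  ≡⟨ cong parity (halvings-half i u) ⟩
  parity (halvings (suc i) u)   ∎
  where open ≡-Reasoning

parityᴾ : PR 1
parityᴾ = R Z (C monusᴾ (constᴾ 1 ∷ P (suc zero) ∷ []))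

parityᴾ-correct : ∀ k → ⟦ parityᴾ ⟧ (k ∷ []) ≡ parity k
parityᴾ-correct zero = refl
parityᴾ-correct (suc k) = trans (monusᴾ-correct 1 (⟦ parityᴾ ⟧ (k ∷ []))) (cong (1 ∸_) (parityᴾ-correct k))

halfᴾ : PR 1
halfᴾ = R Z (C addᴾ (P (suc zero) ∷ C parityᴾ (P zero ∷ []) ∷ []))

halfᴾ-correct : ∀ k → ⟦ halfᴾ ⟧ (k ∷ []) ≡ half k
halfᴾ-correct zero = refl
halfᴾ-correct (suc k) = trans (addᴾ-correct (⟦ halfᴾ ⟧ (k ∷ [])) (⟦ parityᴾ ⟧ (k ∷ [])))
  (cong₂ _+_ (halfᴾ-correct k) (parityᴾ-correct k))

halvingsᴾ : PR 2
halvingsᴾ = R (P zero) (C halfᴾ (P (suc zero) ∷ []))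

halvingsᴾ-correct : ∀ i u → ⟦ halvingsᴾ ⟧ (i ∷ u ∷ []) ≡ halvings i u
halvingsᴾ-correct zero u = refl
halvingsᴾ-correct (suc i) u = trans (halfᴾ-correct (⟦ halvingsᴾ ⟧ (i ∷ u ∷ []))) (cong half (halvingsᴾ-correct i u))

bitᴾ : PR 2
bitᴾ = C parityᴾ (C halvingsᴾ (P (suc zero) ∷ P zero ∷ []) ∷ [])

bitᴾ-correct : ∀ u i → ⟦ bitᴾ ⟧ (u ∷ i ∷ []) ≡ bit u i
bitᴾ-correct u i = begin
  ⟦ parityᴾ ⟧ (⟦ halvingsᴾ ⟧ (i ∷ u ∷ []) ∷ []) ≡⟨ parityᴾ-correct (⟦ halvingsᴾ ⟧ (i ∷ u ∷ [])) ⟩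
  parity (⟦ halvingsᴾ ⟧ (i ∷ u ∷ []))          ≡⟨ cong parity (halvingsᴾ-correct i u) ⟩
  parity (halvings i u)                         ≡⟨ sym (bit≡parity∘halvings u i) ⟩
  bit u i                                       ∎
  where open ≡-Reasoning

triᴾ : PR 1
triᴾ = R Z (C addᴾ (C S (P zero ∷ []) ∷ P (suc zero) ∷ []))

triᴾ-correct : ∀ k → ⟦ triᴾ ⟧ (k ∷ []) ≡ tri k
triᴾ-correct zero = refl
triᴾ-correct (suc k) = trans (addᴾ-correct (suc k) (⟦ triᴾ ⟧ (k ∷ []))) (cong (suc k +_) (triᴾ-correct k))

pairᴾ : PR 2
pairᴾ = C addᴾ (C triᴾ (addᴾ ∷ []) ∷ P (suc zero) ∷ [])

pairᴾ-correct : ∀ n u → ⟦ pairᴾ ⟧ (n ∷ u ∷ []) ≡ ⟨ n , u ⟩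
pairᴾ-correct n u = begin
  ⟦ pairᴾ ⟧ (n ∷ u ∷ [])                    ≡⟨ addᴾ-correct _ u ⟩
  ⟦ triᴾ ⟧ (⟦ addᴾ ⟧ (n ∷ u ∷ []) ∷ []) + u ≡⟨ cong (λ s → ⟦ triᴾ ⟧ (s ∷ []) + u) (addᴾ-correct n u) ⟩
  ⟦ triᴾ ⟧ (n + u ∷ []) + u                 ≡⟨ cong (_+ u) (triᴾ-correct (n + u)) ⟩
  ⟨ n , u ⟩                                 ∎
  where open ≡-Reasoning

tri-mono-< : ∀ {s t} → s < t → s + tri s < tri t
tri-mono-< {s} {suc t} (s≤s s≤t) with m≤n⇒m<n∨m≡n s≤t
... | inj₁ s<t = ≤-trans (tri-mono-< s<t) (m≤n+m (tri t) (suc t))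
... | inj₂ refl = ≤-refl

pair-< : ∀ {n u m v} → n + u < m + v → ⟨ n , u ⟩ < ⟨ m , v ⟩
pair-< {n} {u} {m} {v} lt = begin-strict
  tri (n + u) + u       ≤⟨ +-monoʳ-≤ (tri (n + u)) (m≤n+m u n) ⟩
  tri (n + u) + (n + u) ≡⟨ +-comm (tri (n + u)) (n + u) ⟩
  n + u + tri (n + u)   <⟨ tri-mono-< lt ⟩
  tri (m + v)           ≤⟨ m≤m+n (tri (m + v)) v ⟩
  tri (m + v) + v       ∎
  where open ≤-Reasoning

pair-injective : ∀ {n u m v} → ⟨ n , u ⟩ ≡ ⟨ m , v ⟩ → n ≡ m × u ≡ v
pair-injective {n} {u} {m} {v} eq with <-cmp (n + u) (m + v)
... | tri< lt _ _ = ⊥-elim (<⇒≢ (pair-< {n} {u} {m} {v} lt) eq)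
... | tri> _ _ gt = ⊥-elim (<⇒≢ (pair-< {m} {v} {n} {u} gt) (sym eq))
... | tri≈ _ s≡t _ = n≡m , u≡v
  where
  u≡v : u ≡ v
  u≡v = +-cancelˡ-≡ (tri (m + v)) u v (subst (λ s → tri s + u ≡ tri (m + v) + v) s≡t eq)
  n≡m : n ≡ m
  n≡m = +-cancelʳ-≡ u n m (trans s≡t (cong (m +_) (sym u≡v)))

infixl 6 _+ᵗ_ _∸ᵗ_
infixl 7 _*ᵗ_

data Term (n : ℕ) : Set where
  var : Fin n → Term n
  lit : ℕ → Term n
  _+ᵗ_ _*ᵗ_ _∸ᵗ_ bitᵗ ⟨_,_⟩ᵗ : Term n → Term n → Term n
  app : ∀ {k} → PR k → Vec (Term n) k → Term n
  ∑< ∏< : Term n → Term (suc n) → Term n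

mutual
  eval : ∀ {n} → Term n → Vec ℕ n → ℕ
  eval (var i) xs = lookup xs i
  eval (lit k) xs = k
  eval (a +ᵗ b) xs = eval a xs + eval b xs
  eval (a *ᵗ b) xs = eval a xs * eval b xs
  eval (a ∸ᵗ b) xs = eval a xs ∸ eval b xs
  eval (bitᵗ a b) xs = bit (eval a xs) (eval b xs)
  eval ⟨ a , b ⟩ᵗ xs = ⟨ eval a xs , eval b xs ⟩
  eval (app e ts) xs = ⟦ e ⟧ (evalAll ts xs)
  eval (∑< t s) xs = sumBelow (eval t xs) (λ y → eval s (y ∷ xs))
  eval (∏< t s) xs = productBelow (eval t xs) (λ y → eval s (y ∷ xs))

  evalAll : ∀ {n k} → Vec (Term n) k → Vec ℕ n → Vec ℕ k
  evalAll [] xs = []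
  evalAll (t ∷ ts) xs = eval t xs ∷ evalAll ts xs

sumBelow-cong : ∀ {k l} {f g : ℕ → ℕ} → k ≡ l → (∀ y → f y ≡ g y) → sumBelow k f ≡ sumBelow l g
sumBelow-cong {zero} refl f≗g = refl
sumBelow-cong {suc k} refl f≗g = cong₂ _+_ (sumBelow-cong {k} refl f≗g) (f≗g k)

productBelow-cong : ∀ {k l} {f g : ℕ → ℕ} → k ≡ l → (∀ y → f y ≡ g y) → productBelow k f ≡ productBelow l g
productBelow-cong {zero} refl f≗g = refl
productBelow-cong {suc k} refl f≗g = cong₂ _*_ (productBelow-cong {k} refl f≗g) (f≗g k)

Renaming : ℕ → ℕ → Set
Renaming n m = Fin n → Fin m

lift : ∀ {n m} → Renaming n m → Renaming (suc n) (suc m)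
lift ρ zero = zero
lift ρ (suc i) = suc (ρ i)

reindex : ∀ {n m} → Renaming n m → Vec ℕ m → Vec ℕ n
reindex ρ xs = tabulate (lookup xs ∘ ρ)

mutual
  rename : ∀ {n m} → Renaming n m → Term n → Term m
  rename ρ (var i) = var (ρ i)
  rename ρ (lit k) = lit k
  rename ρ (a +ᵗ b) = rename ρ a +ᵗ rename ρ b
  rename ρ (a *ᵗ b) = rename ρ a *ᵗ rename ρ b
  rename ρ (a ∸ᵗ b) = rename ρ a ∸ᵗ rename ρ b
  rename ρ (bitᵗ a b) = bitᵗ (rename ρ a) (rename ρ b)
  rename ρ ⟨ a , b ⟩ᵗ = ⟨ rename ρ a , rename ρ b ⟩ᵗ
  rename ρ (app e ts) = app e (renameAll ρ ts)
  rename ρ (∑< t s) = ∑< (rename ρ t) (rename (lift ρ) s)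
  rename ρ (∏< t s) = ∏< (rename ρ t) (rename (lift ρ) s)

  renameAll : ∀ {n m k} → Renaming n m → Vec (Term n) k → Vec (Term m) k
  renameAll ρ [] = []
  renameAll ρ (t ∷ ts) = rename ρ t ∷ renameAll ρ ts

mutual
  rename-correct : ∀ {n m} (ρ : Renaming n m) t xs → eval (rename ρ t) xs ≡ eval t (reindex ρ xs)
  rename-correct ρ (var i) xs = sym (lookup∘tabulate (lookup xs ∘ ρ) i)
  rename-correct ρ (lit k) xs = refl
  rename-correct ρ (a +ᵗ b) xs = cong₂ _+_ (rename-correct ρ a xs) (rename-correct ρ b xs)
  rename-correct ρ (a *ᵗ b) xs = cong₂ _*_ (rename-correct ρ a xs) (rename-correct ρ b xs)
  rename-correct ρ (a ∸ᵗ b) xs = cong₂ _∸_ (rename-correct ρ a xs) (rename-correct ρ b xs)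
  rename-correct ρ (bitᵗ a b) xs = cong₂ bit (rename-correct ρ a xs) (rename-correct ρ b xs)
  rename-correct ρ ⟨ a , b ⟩ᵗ xs = cong₂ ⟨_,_⟩ (rename-correct ρ a xs) (rename-correct ρ b xs)
  rename-correct ρ (app e ts) xs = cong ⟦ e ⟧ (renameAll-correct ρ ts xs)
  rename-correct ρ (∑< t s) xs =
    sumBelow-cong (rename-correct ρ t xs) (λ y → rename-correct (lift ρ) s (y ∷ xs))
  rename-correct ρ (∏< t s) xs =
    productBelow-cong (rename-correct ρ t xs) (λ y → rename-correct (lift ρ) s (y ∷ xs))

  renameAll-correct : ∀ {n m k} (ρ : Renaming n m) (ts : Vec (Term n) k) xs →
                      evalAll (renameAll ρ ts) xs ≡ evalAll ts (reindex ρ xs)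
  renameAll-correct ρ [] xs = refl
  renameAll-correct ρ (t ∷ ts) xs = cong₂ _∷_ (rename-correct ρ t xs) (renameAll-correct ρ ts xs)

reindex-punchIn : ∀ {n} (xs : Vec ℕ n) i v → reindex (punchIn i) (insertAt xs i v) ≡ xs
reindex-punchIn xs i v = trans (tabulate-cong (insertAt-punchIn xs i v)) (tabulate∘lookup xs)

weaken-correct : ∀ {n} i (t : Term n) xs v → eval (rename (punchIn i) t) (insertAt xs i v) ≡ eval t xs
weaken-correct i t xs v = trans (rename-correct (punchIn i) t _) (cong (eval t) (reindex-punchIn xs i v))

swap : ∀ {n} → Renaming (suc (suc n)) (suc (suc n))
swap zero = suc zero
swap (suc zero) = zero
swap (suc (suc i)) = suc (suc i)

reindex-swap : ∀ {n} x y (xs : Vec ℕ n) → reindex swap (x ∷ y ∷ xs) ≡ y ∷ x ∷ xs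
reindex-swap x y xs = cong (λ zs → y ∷ x ∷ zs) (tabulate∘lookup xs)

swap-correct : ∀ {n} (t : Term (suc (suc n))) x y xs → eval (rename swap t) (x ∷ y ∷ xs) ≡ eval t (y ∷ x ∷ xs)
swap-correct t x y xs = trans (rename-correct swap t (x ∷ y ∷ xs)) (cong (eval t) (reindex-swap x y xs))

mutual
  compile : ∀ {n} → Term n → PR n
  compile (var i) = P i
  compile (lit k) = constᴾ k
  compile (a +ᵗ b) = C addᴾ (compile a ∷ compile b ∷ [])
  compile (a *ᵗ b) = C mulᴾ (compile a ∷ compile b ∷ [])
  compile (a ∸ᵗ b) = C monusᴾ (compile a ∷ compile b ∷ [])
  compile (bitᵗ a b) = C bitᴾ (compile a ∷ compile b ∷ [])
  compile ⟨ a , b ⟩ᵗ = C pairᴾ (compile a ∷ compile b ∷ [])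
  compile (app e ts) = C e (compileAll ts)
  compile (∑< t s) = C (sumᴾ (compile s)) (compile t ∷ projections)
  compile (∏< t s) = C (productᴾ (compile s)) (compile t ∷ projections)

  compileAll : ∀ {n k} → Vec (Term n) k → Vec (PR n) k
  compileAll [] = []
  compileAll (t ∷ ts) = compile t ∷ compileAll ts

mutual
  compile-correct : ∀ {n} (t : Term n) xs → ⟦ compile t ⟧ xs ≡ eval t xs
  compile-correct (var i) xs = refl
  compile-correct (lit k) xs = constᴾ-correct k xs
  compile-correct (a +ᵗ b) xs = compile-correct₂ addᴾ addᴾ-correct a b xs
  compile-correct (a *ᵗ b) xs = compile-correct₂ mulᴾ mulᴾ-correct a b xs
  compile-correct (a ∸ᵗ b) xs = compile-correct₂ monusᴾ monusᴾ-correct a b xs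
  compile-correct (bitᵗ a b) xs = compile-correct₂ bitᴾ bitᴾ-correct a b xs
  compile-correct ⟨ a , b ⟩ᵗ xs = compile-correct₂ pairᴾ pairᴾ-correct a b xs
  compile-correct (app e ts) xs = cong ⟦ e ⟧ (compileAll-correct ts xs)
  compile-correct (∑< t s) xs rewrite projections-correct xs =
    trans (sumᴾ-correct (compile s) (⟦ compile t ⟧ xs) xs)
          (sumBelow-cong (compile-correct t xs) (λ y → compile-correct s (y ∷ xs)))
  compile-correct (∏< t s) xs rewrite projections-correct xs =
    trans (productᴾ-correct (compile s) (⟦ compile t ⟧ xs) xs)
          (productBelow-cong (compile-correct t xs) (λ y → compile-correct s (y ∷ xs)))

  compile-correct₂ : ∀ {n} (op : PR 2) {f : ℕ → ℕ → ℕ} → (∀ x y → ⟦ op ⟧ (x ∷ y ∷ []) ≡ f x y) →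
                     ∀ (a b : Term n) xs → ⟦ C op (compile a ∷ compile b ∷ []) ⟧ xs ≡ f (eval a xs) (eval b xs)
  compile-correct₂ op {f} op-correct a b xs =
    trans (op-correct (⟦ compile a ⟧ xs) (⟦ compile b ⟧ xs)) (cong₂ f (compile-correct a xs) (compile-correct b xs))

  compileAll-correct : ∀ {n k} (ts : Vec (Term n) k) xs → evals (compileAll ts) xs ≡ evalAll ts xs
  compileAll-correct [] xs = refl
  compileAll-correct (t ∷ ts) xs = cong₂ _∷_ (compile-correct t xs) (compileAll-correct ts xs)

-- Σ₁ formulas and their normal form  ∃y. t(y, xs) = 0

infix 5 _≈_
infixr 3 _∧_
infixr 2 _∨_

data Σ₁ (n : ℕ) : Set where
  _≈_ : Term n → Term n → Σ₁ n
  _∧_ _∨_ : Σ₁ n → Σ₁ n → Σ₁ n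
  ∃ᶠ : Σ₁ (suc n) → Σ₁ n
  ∀< : Term n → Σ₁ (suc n) → Σ₁ n

⟦_⟧ˢ : ∀ {n} → Σ₁ n → Vec ℕ n → Set
⟦ a ≈ b ⟧ˢ xs = eval a xs ≡ eval b xs
⟦ φ ∧ ψ ⟧ˢ xs = ⟦ φ ⟧ˢ xs × ⟦ ψ ⟧ˢ xs
⟦ φ ∨ ψ ⟧ˢ xs = ⟦ φ ⟧ˢ xs ⊎ ⟦ ψ ⟧ˢ xs
⟦ ∃ᶠ φ ⟧ˢ xs = ∃ λ y → ⟦ φ ⟧ˢ (y ∷ xs)
⟦ ∀< t φ ⟧ˢ xs = ∀ y → y < eval t xs → ⟦ φ ⟧ˢ (y ∷ xs)

rename₁ : ∀ {n m} → Renaming n m → Σ₁ n → Σ₁ m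
rename₁ ρ (a ≈ b) = rename ρ a ≈ rename ρ b
rename₁ ρ (φ ∧ ψ) = rename₁ ρ φ ∧ rename₁ ρ ψ
rename₁ ρ (φ ∨ ψ) = rename₁ ρ φ ∨ rename₁ ρ ψ
rename₁ ρ (∃ᶠ φ) = ∃ᶠ (rename₁ (lift ρ) φ)
rename₁ ρ (∀< t φ) = ∀< (rename ρ t) (rename₁ (lift ρ) φ)

rename₁-correct : ∀ {n m} (ρ : Renaming n m) φ xs → ⟦ rename₁ ρ φ ⟧ˢ xs ⇔ ⟦ φ ⟧ˢ (reindex ρ xs)
rename₁-correct ρ (a ≈ b) xs = ≡-⇔ (rename-correct ρ a xs) (rename-correct ρ b xs)
rename₁-correct ρ (φ ∧ ψ) xs = rename₁-correct ρ φ xs ×-⇔ rename₁-correct ρ ψ xs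
rename₁-correct ρ (φ ∨ ψ) xs = rename₁-correct ρ φ xs ⊎-⇔ rename₁-correct ρ ψ xs
rename₁-correct ρ (∃ᶠ φ) xs = ∃-⇔ (λ y → rename₁-correct (lift ρ) φ (y ∷ xs))
rename₁-correct ρ (∀< t φ) xs = ∀<-⇔ (rename-correct ρ t xs) (λ y → rename₁-correct (lift ρ) φ (y ∷ xs))

weaken₁-correct : ∀ {n} i (φ : Σ₁ n) xs v → ⟦ rename₁ (punchIn i) φ ⟧ˢ (insertAt xs i v) ⇔ ⟦ φ ⟧ˢ xs
weaken₁-correct i φ xs v =
  subst (λ ys → ⟦ rename₁ (punchIn i) φ ⟧ˢ (insertAt xs i v) ⇔ ⟦ φ ⟧ˢ ys) (reindex-punchIn xs i v)
    (rename₁-correct (punchIn i) φ (insertAt xs i v))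

swap₁-correct : ∀ {n} (φ : Σ₁ (suc (suc n))) x y xs → ⟦ rename₁ swap φ ⟧ˢ (x ∷ y ∷ xs) ⇔ ⟦ φ ⟧ˢ (y ∷ x ∷ xs)
swap₁-correct φ x y xs =
  subst (λ ys → ⟦ rename₁ swap φ ⟧ˢ (x ∷ y ∷ xs) ⇔ ⟦ φ ⟧ˢ ys) (reindex-swap x y xs)
    (rename₁-correct swap φ (x ∷ y ∷ xs))

Σ₁NormalForm : ∀ {n} → (Vec ℕ n → Set) → Set
Σ₁NormalForm {n} Q = Σ (Term (suc n)) λ t → ∀ xs → Q xs ⇔ ∃ λ y → eval t (y ∷ xs) ≡ 0

≈-normal : ∀ {n} (a b : Term n) → Σ₁NormalForm ⟦ a ≈ b ⟧ˢ
≈-normal a b = rename (punchIn zero) distance , λ xs → mk⇔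
  (λ a≡b → 0 , trans (weaken-correct zero distance xs 0) (from (distance≡0⇔≡ _ _) a≡b))
  (λ (y , d≡0) → to (distance≡0⇔≡ _ _) (trans (sym (weaken-correct zero distance xs y)) d≡0))
  where distance = a ∸ᵗ b +ᵗ (b ∸ᵗ a)

∨-normal : ∀ {n} {Q R : Vec ℕ n → Set} → Σ₁NormalForm Q → Σ₁NormalForm R → Σ₁NormalForm (λ xs → Q xs ⊎ R xs)
∨-normal (t , Q⇔) (s , R⇔) = t *ᵗ s , λ xs → mk⇔
  (λ { (inj₁ q) → let (y , ty≡0) = to (Q⇔ xs) q in y , from (*≡0⇔ _ _) (inj₁ ty≡0)
     ; (inj₂ r) → let (y , sy≡0) = to (R⇔ xs) r in y , from (*≡0⇔ (eval t (y ∷ xs)) _) (inj₂ sy≡0) })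
  (λ (y , p≡0) → case to (*≡0⇔ (eval t (y ∷ xs)) (eval s (y ∷ xs))) p≡0 of λ
     { (inj₁ ty≡0) → inj₁ (from (Q⇔ xs) (y , ty≡0))
     ; (inj₂ sy≡0) → inj₂ (from (R⇔ xs) (y , sy≡0)) })

someBelow : ∀ {n} → Term (suc n) → Term (suc n)
someBelow t = ∏< (var zero) (rename (punchIn (suc zero)) t)

someBelow-correct : ∀ {n} (t : Term (suc n)) M xs →
                    (eval (someBelow t) (M ∷ xs) ≡ 0) ⇔ (∃ λ y → y < M × eval t (y ∷ xs) ≡ 0)
someBelow-correct t M xs = ⇔-trans (productBelow≡0⇔ M _)
  (∃-⇔ λ y → ⇔-refl ×-⇔ ≡-⇔ (weaken-correct (suc zero) t (y ∷ xs) M) refl)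

witness-below : ∀ {n} (t : Term (suc n)) {M y} xs → y < M → eval t (y ∷ xs) ≡ 0 → eval (someBelow t) (M ∷ xs) ≡ 0
witness-below t {M} {y} xs y<M ty≡0 = from (someBelow-correct t M xs) (y , y<M , ty≡0)

witness-unbounded : ∀ {n} (t : Term (suc n)) {M} xs → eval (someBelow t) (M ∷ xs) ≡ 0 → ∃ λ y → eval t (y ∷ xs) ≡ 0
witness-unbounded t {M} xs s≡0 = let (y , _ , ty≡0) = to (someBelow-correct t M xs) s≡0 in y , ty≡0

∧-normal : ∀ {n} {Q R : Vec ℕ n → Set} → Σ₁NormalForm Q → Σ₁NormalForm R → Σ₁NormalForm (λ xs → Q xs × R xs)
∧-normal (t , Q⇔) (s , R⇔) = someBelow t +ᵗ someBelow s , λ xs → mk⇔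
  (λ (q , r) →
    let (y₁ , t≡0) = to (Q⇔ xs) q
        (y₂ , s≡0) = to (R⇔ xs) r
    in suc (y₁ + y₂) , cong₂ _+_ (witness-below t xs (s≤s (m≤m+n y₁ y₂)) t≡0)
                                 (witness-below s xs (s≤s (m≤n+m y₂ y₁)) s≡0))
  (λ (M , sum≡0) →
    from (Q⇔ xs) (witness-unbounded t {M} xs (m+n≡0⇒m≡0 _ sum≡0)) ,
    from (R⇔ xs) (witness-unbounded s {M} xs (m+n≡0⇒n≡0 (eval (someBelow t) (M ∷ xs)) sum≡0)))

∃-normal : ∀ {n} {Q : Vec ℕ (suc n) → Set} → Σ₁NormalForm Q → Σ₁NormalForm (λ xs → ∃ λ z → Q (z ∷ xs))
∃-normal (t , Q⇔) = ∏< (var zero) (rename swap (someBelow t)) , λ xs → mk⇔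
  (λ (z , q) →
    let (y , t≡0) = to (Q⇔ (z ∷ xs)) q
        M = suc (z + y)
    in M , from (productBelow≡0⇔ M _) (z , s≤s (m≤m+n z y) ,
             trans (swap-correct (someBelow t) z M xs) (witness-below t (z ∷ xs) (s≤s (m≤n+m y z)) t≡0)))
  (λ (M , p≡0) →
    let (z , _ , s≡0) = to (productBelow≡0⇔ M _) p≡0
    in z , from (Q⇔ (z ∷ xs)) (witness-unbounded t {M} (z ∷ xs) (trans (sym (swap-correct (someBelow t) z M xs)) s≡0)))

-- All witnesses for i < b fit below one bound M, turning ∀< into a sum of bounded products.
∀<-normal : ∀ {n} (b : Term n) {Q : Vec ℕ (suc n) → Set} → Σ₁NormalForm Q →
            Σ₁NormalForm (λ xs → ∀ i → i < eval b xs → Q (i ∷ xs))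
∀<-normal b (t , Q⇔) = ∑< (rename (punchIn zero) b) (rename swap (someBelow t)) , λ xs → mk⇔
  (λ q →
    let (M , below-M) = collect-bound (eval b xs) (λ i y → eval t (y ∷ i ∷ xs) ≡ 0) (λ i i<b → to (Q⇔ (i ∷ xs)) (q i i<b))
    in M , from (sumBelow≡0⇔ _ _) λ i i<b →
      let (y , y<M , t≡0) = below-M i (subst (i <_) (weaken-correct zero b xs M) i<b)
      in trans (swap-correct (someBelow t) i M xs) (witness-below t (i ∷ xs) y<M t≡0))
  (λ (M , s≡0) i i<b →
    from (Q⇔ (i ∷ xs)) (witness-unbounded t {M} (i ∷ xs)
      (trans (sym (swap-correct (someBelow t) i M xs))
        (to (sumBelow≡0⇔ _ _) s≡0 i (subst (i <_) (sym (weaken-correct zero b xs M)) i<b)))))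

Σ₁-normal-form : ∀ {n} (φ : Σ₁ n) → Σ₁NormalForm ⟦ φ ⟧ˢ
Σ₁-normal-form (a ≈ b) = ≈-normal a b
Σ₁-normal-form (φ ∧ ψ) = ∧-normal (Σ₁-normal-form φ) (Σ₁-normal-form ψ)
Σ₁-normal-form (φ ∨ ψ) = ∨-normal (Σ₁-normal-form φ) (Σ₁-normal-form ψ)
Σ₁-normal-form (∃ᶠ φ) = ∃-normal (Σ₁-normal-form φ)
Σ₁-normal-form (∀< b φ) = ∀<-normal b (Σ₁-normal-form φ)

_codes_ : ℕ → Subset → Set
u codes Q = ∀ j → D u j ⇔ Q j

D? : ∀ u j → Dec (D u j)
D? u j = bit u j ≟ 1

code-of : (Q : Subset) → (∀ j → Dec (Q j)) → ∀ B → (∀ j → Q j → j < B) → ∃ λ u → u codes Q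
code-of Q Q? zero bounded = 0 , λ j → mk⇔ (⊥-elim ∘ D-0-empty j) (λ q → ⊥-elim (n≮0 (bounded j q)))
code-of Q Q? (suc B) bounded with code-of (Q ∘ suc) (Q? ∘ suc) B (λ j q → ≤-pred (bounded (suc j) q)) | Q? 0
... | w , w-codes | yes q₀ = 1 + w * 2 , λ
  { zero → mk⇔ (λ _ → q₀) (λ _ → bit-zero-digit w (s≤s (s≤s z≤n)))
  ; (suc j) → ⇔-trans (≡-⇔ (bit-suc-digit w j (s≤s (s≤s z≤n))) refl) (w-codes j) }
... | w , w-codes | no ¬q₀ = 0 + w * 2 , λ
  { zero → mk⇔ (λ d → ⊥-elim (0≢1 (trans (sym (bit-zero-digit w (s≤s z≤n))) d))) (⊥-elim ∘ ¬q₀)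
  ; (suc j) → ⇔-trans (≡-⇔ (bit-suc-digit w j (s≤s z≤n)) refl) (w-codes j) }

∪-code : ∀ a b → ∃ λ w → w codes (λ z → D a z ⊎ D b z)
∪-code a b = code-of _ (λ z → D? a z ⊎-dec D? b z) (a + b) λ
  { z (inj₁ d) → ≤-trans (D-bounded a z d) (m≤m+n a b)
  ; z (inj₂ d) → ≤-trans (D-bounded b z d) (m≤n+m b a) }

singleton-code : ∀ i → ∃ λ w → w codes (_≡ i)
singleton-code i = code-of _ (_≟ i) (suc i) λ { z refl → ≤-refl }

collect-codes : ∀ k (Q : ℕ → ℕ → Set) → (∀ i → i < k → ∃ (Q i)) →
                ∃ λ w → (∀ i → i < k → ∃ λ u → Q i u × D u ⊆ D w)
                      × (∀ z → D w z → ∃ λ i → i < k × ∃ λ u → Q i u × D u ⊆ D w × D u z)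
collect-codes zero Q witness = 0 , (λ i ()) , λ z d → ⊥-elim (D-0-empty z d)
collect-codes (suc k) Q witness =
  let (w₀ , covers₀ , from-w₀) = collect-codes k Q (λ i i<k → witness i (m<n⇒m<1+n i<k))
      (uₖ , Qkuₖ) = witness k ≤-refl
      (w , w-codes) = ∪-code w₀ uₖ
      w₀⊆w : D w₀ ⊆ D w
      w₀⊆w z d = from (w-codes z) (inj₁ d)
      uₖ⊆w : D uₖ ⊆ D w
      uₖ⊆w z d = from (w-codes z) (inj₂ d)
  in w ,
     (λ i i<1+k → case m<1+n⇒m<n∨m≡n i<1+k of λ
       { (inj₁ i<k) → let (u , Qiu , u⊆w₀) = covers₀ i i<k in u , Qiu , λ z d → w₀⊆w z (u⊆w₀ z d)
       ; (inj₂ refl) → uₖ , Qkuₖ , uₖ⊆w }) ,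
     λ z d → case to (w-codes z) d of λ
       { (inj₁ d₀) → let (i , i<k , u , Qiu , u⊆w₀ , dᵤ) = from-w₀ z d₀
                     in i , m<n⇒m<1+n i<k , u , Qiu , (λ y e → w₀⊆w y (u⊆w₀ y e)) , dᵤ
       ; (inj₂ dₖ) → k , ≤-refl , uₖ , Qkuₖ , uₖ⊆w , dₖ }

∀∈-⇔ : ∀ {A : ℕ → Set} u → (∀ z → z < u → bit u z ≡ 0 ⊎ A z) ⇔ (∀ z → D u z → A z)
∀∈-⇔ u = mk⇔
  (λ h z d → case h z (D-bounded u z d) of λ
    { (inj₁ b≡0) → ⊥-elim (0≢1 (trans (sym b≡0) d))
    ; (inj₂ a) → a })
  (λ h z _ → case bit-binary u z of λ
    { (inj₁ b≡0) → inj₁ b≡0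
    ; (inj₂ d) → inj₂ (h z d) })

∀∈ˢ : ∀ {n} → Term n → Σ₁ (suc n) → Σ₁ n
∀∈ˢ t φ = ∀< t (bitᵗ (rename (punchIn zero) t) (var zero) ≈ lit 0 ∨ φ)

∀∈ˢ-correct : ∀ {n} t (φ : Σ₁ (suc n)) xs → ⟦ ∀∈ˢ t φ ⟧ˢ xs ⇔ (∀ z → D (eval t xs) z → ⟦ φ ⟧ˢ (z ∷ xs))
∀∈ˢ-correct t φ xs = ⇔-trans
  (∀<-⇔ refl λ z → ≡-⇔ (cong (λ v → bit v z) (weaken-correct zero t xs z)) refl ⊎-⇔ ⇔-refl)
  (∀∈-⇔ (eval t xs))

_⊆ˢ_ : ∀ {n} → Term n → Term n → Σ₁ n
a ⊆ˢ b = ∀∈ˢ a (bitᵗ (rename (punchIn zero) b) (var zero) ≈ lit 1)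

⊆ˢ-correct : ∀ {n} (a b : Term n) xs → ⟦ a ⊆ˢ b ⟧ˢ xs ⇔ (D (eval a xs) ⊆ D (eval b xs))
⊆ˢ-correct a b xs = ⇔-trans (∀∈ˢ-correct a (bitᵗ (rename (punchIn zero) b) (var zero) ≈ lit 1) xs)
  (∀-⇔ λ z → ∀-⇔ λ _ → ≡-⇔ (cong (λ v → bit v z) (weaken-correct zero b xs z)) refl)

-- Formulas positive in an oracle set, and their normal form  ∃u. ψ(u, xs) ∧ D_u ⊆ Y

data Pos (n : ℕ) : Set where
  ⌜_⌝ : Σ₁ n → Pos n
  oracle : Term n → Pos n
  _∧_ _∨_ : Pos n → Pos n → Pos n
  ∃ᶠ : Pos (suc n) → Pos n
  ∀< : Term n → Pos (suc n) → Pos n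

⟦_⟧ᵖ : ∀ {n} → Pos n → Subset → Vec ℕ n → Set
⟦ ⌜ φ ⌝ ⟧ᵖ Y xs = ⟦ φ ⟧ˢ xs
⟦ oracle t ⟧ᵖ Y xs = Y (eval t xs)
⟦ φ ∧ ψ ⟧ᵖ Y xs = ⟦ φ ⟧ᵖ Y xs × ⟦ ψ ⟧ᵖ Y xs
⟦ φ ∨ ψ ⟧ᵖ Y xs = ⟦ φ ⟧ᵖ Y xs ⊎ ⟦ ψ ⟧ᵖ Y xs
⟦ ∃ᶠ φ ⟧ᵖ Y xs = ∃ λ y → ⟦ φ ⟧ᵖ Y (y ∷ xs)
⟦ ∀< t φ ⟧ᵖ Y xs = ∀ y → y < eval t xs → ⟦ φ ⟧ᵖ Y (y ∷ xs)

PosNormalForm : ∀ {n} → Subset → (Vec ℕ n → Set) → Set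
PosNormalForm {n} Y Q = Σ (Σ₁ (suc n)) λ ψ → ∀ xs → Q xs ⇔ ∃ λ u → ⟦ ψ ⟧ˢ (u ∷ xs) × D u ⊆ Y

Σ₁-pos : ∀ {n} {Y} (φ : Σ₁ n) → PosNormalForm Y ⟦ φ ⟧ˢ
Σ₁-pos φ = rename₁ (punchIn zero) φ , λ xs → mk⇔
  (λ p → 0 , from (weaken₁-correct zero φ xs 0) p , λ z d → ⊥-elim (D-0-empty z d))
  (λ (u , p , _) → to (weaken₁-correct zero φ xs u) p)

oracle-pos : ∀ {n} {Y} (t : Term n) → PosNormalForm Y (λ xs → Y (eval t xs))
oracle-pos {Y = Y} t = bitᵗ (var zero) t′ ≈ lit 1 , λ xs → mk⇔
  (λ y → let (w , w-codes) = singleton-code (eval t xs) in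
    w , subst (λ v → bit w v ≡ 1) (sym (weaken-correct zero t xs w)) (from (w-codes _) refl) ,
    λ z d → subst Y (sym (to (w-codes z) d)) y)
  (λ (u , d , u⊆Y) → u⊆Y _ (subst (λ v → bit u v ≡ 1) (weaken-correct zero t xs u) d))
  where t′ = rename (punchIn zero) t

∨-pos : ∀ {n} {Y} {Q R : Vec ℕ n → Set} → PosNormalForm Y Q → PosNormalForm Y R → PosNormalForm Y (λ xs → Q xs ⊎ R xs)
∨-pos (ψ , Q⇔) (χ , R⇔) = (ψ ∨ χ) , λ xs → mk⇔
  (λ { (inj₁ q) → let (u , p , u⊆Y) = to (Q⇔ xs) q in u , inj₁ p , u⊆Y
     ; (inj₂ r) → let (u , p , u⊆Y) = to (R⇔ xs) r in u , inj₂ p , u⊆Y })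
  (λ { (u , inj₁ p , u⊆Y) → inj₁ (from (Q⇔ xs) (u , p , u⊆Y))
     ; (u , inj₂ p , u⊆Y) → inj₂ (from (R⇔ xs) (u , p , u⊆Y)) })

witnessWithin : ∀ {n} → Σ₁ (suc n) → Σ₁ (suc n)
witnessWithin ψ = ∃ᶠ (rename₁ (punchIn (suc zero)) ψ ∧ (var zero ⊆ˢ var (suc zero)))

witnessWithin-correct : ∀ {n} (ψ : Σ₁ (suc n)) w xs →
                        ⟦ witnessWithin ψ ⟧ˢ (w ∷ xs) ⇔ (∃ λ u → ⟦ ψ ⟧ˢ (u ∷ xs) × D u ⊆ D w)
witnessWithin-correct ψ w xs = ∃-⇔ λ u →
  weaken₁-correct (suc zero) ψ (u ∷ xs) w ×-⇔ ⊆ˢ-correct (var zero) (var (suc zero)) (u ∷ w ∷ xs)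

∧-pos : ∀ {n} {Y} {Q R : Vec ℕ n → Set} → PosNormalForm Y Q → PosNormalForm Y R → PosNormalForm Y (λ xs → Q xs × R xs)
∧-pos (ψ , Q⇔) (χ , R⇔) = (witnessWithin ψ ∧ witnessWithin χ) , λ xs → mk⇔
  (λ (q , r) →
    let (u₁ , p₁ , u₁⊆Y) = to (Q⇔ xs) q
        (u₂ , p₂ , u₂⊆Y) = to (R⇔ xs) r
        (w , w-codes) = ∪-code u₁ u₂
    in w , (from (witnessWithin-correct ψ w xs) (u₁ , p₁ , λ z d → from (w-codes z) (inj₁ d)) ,
            from (witnessWithin-correct χ w xs) (u₂ , p₂ , λ z d → from (w-codes z) (inj₂ d))) ,
       λ z d → case to (w-codes z) d of λ { (inj₁ d₁) → u₁⊆Y z d₁ ; (inj₂ d₂) → u₂⊆Y z d₂ })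
  (λ (w , (p , p′) , w⊆Y) →
    let (u₁ , p₁ , u₁⊆w) = to (witnessWithin-correct ψ w xs) p
        (u₂ , p₂ , u₂⊆w) = to (witnessWithin-correct χ w xs) p′
    in from (Q⇔ xs) (u₁ , p₁ , λ z d → w⊆Y z (u₁⊆w z d)) , from (R⇔ xs) (u₂ , p₂ , λ z d → w⊆Y z (u₂⊆w z d)))

∃-pos : ∀ {n} {Y} {Q : Vec ℕ (suc n) → Set} → PosNormalForm Y Q → PosNormalForm Y (λ xs → ∃ λ z → Q (z ∷ xs))
∃-pos (ψ , Q⇔) = ∃ᶠ (rename₁ swap ψ) , λ xs → mk⇔
  (λ (z , q) → let (u , p , u⊆Y) = to (Q⇔ (z ∷ xs)) q in u , (z , from (swap₁-correct ψ z u xs) p) , u⊆Y)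
  (λ (u , (z , p) , u⊆Y) → z , from (Q⇔ (z ∷ xs)) (u , to (swap₁-correct ψ z u xs) p , u⊆Y))

∀<-pos : ∀ {n} {Y} (b : Term n) {Q : Vec ℕ (suc n) → Set} → PosNormalForm Y Q →
         PosNormalForm Y (λ xs → ∀ i → i < eval b xs → Q (i ∷ xs))
∀<-pos b (ψ , Q⇔) = ∀< (rename (punchIn zero) b) (rename₁ swap (witnessWithin ψ)) , λ xs → mk⇔
  (λ q →
    let (w , covered , from-w) = collect-codes (eval b xs) (λ i u → ⟦ ψ ⟧ˢ (u ∷ i ∷ xs) × D u ⊆ _)
                                               (λ i i<b → let (u , p , u⊆Y) = to (Q⇔ (i ∷ xs)) (q i i<b) in u , p , u⊆Y)
    in w ,
       (λ i i<b′ → let (u , (p , _) , u⊆w) = covered i (subst (i <_) (weaken-correct zero b xs w) i<b′) in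
         from (swap₁-correct (witnessWithin ψ) i w xs) (from (witnessWithin-correct ψ w (i ∷ xs)) (u , p , u⊆w))) ,
       λ z d → let (_ , _ , _ , (_ , u⊆Y) , _ , dᵤ) = from-w z d in u⊆Y z dᵤ)
  (λ (w , p , w⊆Y) i i<b →
    let (u , pᵤ , u⊆w) = to (witnessWithin-correct ψ w (i ∷ xs))
                           (to (swap₁-correct (witnessWithin ψ) i w xs) (p i (subst (i <_) (sym (weaken-correct zero b xs w)) i<b)))
    in from (Q⇔ (i ∷ xs)) (u , pᵤ , λ z d → w⊆Y z (u⊆w z d)))

pos-normal-form : ∀ {n} {Y} (φ : Pos n) → PosNormalForm Y (⟦ φ ⟧ᵖ Y)
pos-normal-form ⌜ φ ⌝ = Σ₁-pos φ
pos-normal-form (oracle t) = oracle-pos t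
pos-normal-form (φ ∧ ψ) = ∧-pos (pos-normal-form φ) (pos-normal-form ψ)
pos-normal-form (φ ∨ ψ) = ∨-pos (pos-normal-form φ) (pos-normal-form ψ)
pos-normal-form (∃ᶠ φ) = ∃-pos (pos-normal-form φ)
pos-normal-form (∀< b φ) = ∀<-pos b (pos-normal-form φ)

definable⇒≤e : ∀ {A Y} (φ : Pos 1) → (∀ x → A x ⇔ ⟦ φ ⟧ᵖ Y (x ∷ [])) → A ≤e Y
definable⇒≤e {A} {Y} φ A⇔φ = e , λ x → begin
  A x                                                        ∼⟨ A⇔φ x ⟩
  ⟦ φ ⟧ᵖ Y (x ∷ [])                                          ∼⟨ ψ⇔ (x ∷ []) ⟩
  (∃ λ u → ⟦ ψ ⟧ˢ (u ∷ x ∷ []) × D u ⊆ Y)                   ∼⟨ ∃-⇔ (λ u → t⇔ (u ∷ x ∷ []) ×-⇔ ⇔-refl) ⟩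
  (∃ λ u → (∃ λ y → eval t (y ∷ u ∷ x ∷ []) ≡ 0) × D u ⊆ Y)
    ∼⟨ ∃-⇔ (λ u → ∃-⇔ (λ y → ≡-⇔ (sym (e-correct y x u)) refl) ×-⇔ ⇔-refl) ⟩
  (∃ λ u → Halts e (x ∷ u ∷ []) × D u ⊆ Y)                  ∎
  where
  open EquationalReasoning
  ψ = proj₁ (pos-normal-form φ)
  ψ⇔ = proj₂ (pos-normal-form φ)
  t = proj₁ (Σ₁-normal-form ψ)
  t⇔ = proj₂ (Σ₁-normal-form ψ)
  e = compile (rename (lift swap) t)
  e-correct : ∀ y x u → ⟦ e ⟧ (y ∷ x ∷ u ∷ []) ≡ eval t (y ∷ u ∷ x ∷ [])
  e-correct y x u = trans (compile-correct (rename (lift swap) t) _) (rename-correct (lift swap) t _)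

∀∈ᵖ : ∀ {n} → Term n → Pos (suc n) → Pos n
∀∈ᵖ t φ = ∀< t (⌜ bitᵗ (rename (punchIn zero) t) (var zero) ≈ lit 0 ⌝ ∨ φ)

∀∈ᵖ-correct : ∀ {n} {Y} t (φ : Pos (suc n)) xs →
              ⟦ ∀∈ᵖ t φ ⟧ᵖ Y xs ⇔ (∀ z → D (eval t xs) z → ⟦ φ ⟧ᵖ Y (z ∷ xs))
∀∈ᵖ-correct t φ xs = ⇔-trans
  (∀<-⇔ refl λ z → ≡-⇔ (cong (λ v → bit v z) (weaken-correct zero t xs z)) refl ⊎-⇔ ⇔-refl)
  (∀∈-⇔ (eval t xs))

weaken₂ : ∀ {n} → Term n → Term (suc (suc n))
weaken₂ t = rename (punchIn zero) (rename (punchIn zero) t)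

weaken₂-correct : ∀ {n} (t : Term n) y u xs → eval (weaken₂ t) (y ∷ u ∷ xs) ≡ eval t xs
weaken₂-correct t y u xs = trans (weaken-correct zero (rename (punchIn zero) t) (u ∷ xs) y) (weaken-correct zero t xs u)

-- Membership of t in the set reduced by e, where χ(z) expresses membership of z in the oracle of e.
reduce : ∀ {n} → PR 3 → Term n → Pos (suc (suc n)) → Pos n
reduce e t χ = ∃ᶠ (⌜ ∃ᶠ (app e (var zero ∷ weaken₂ t ∷ var (suc zero) ∷ []) ≈ lit 0) ⌝ ∧ ∀∈ᵖ (var zero) χ)

reduce-correct : ∀ {n} {A X Y} (A≤X : A ≤e X) (t : Term n) χ → (∀ z u xs → ⟦ χ ⟧ᵖ Y (z ∷ u ∷ xs) ⇔ X z) →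
                 ∀ xs → ⟦ reduce (proj₁ A≤X) t χ ⟧ᵖ Y xs ⇔ A (eval t xs)
reduce-correct {A = A} {X} {Y} (e , A⇔) t χ χ⇔X xs = begin
  ⟦ reduce e t χ ⟧ᵖ Y xs                            ∼⟨ ∃-⇔ (λ u → halts⇔ u ×-⇔ within⇔ u) ⟩
  (∃ λ u → Halts e (eval t xs ∷ u ∷ []) × D u ⊆ X) ∼⟨ ⇔-sym (A⇔ (eval t xs)) ⟩
  A (eval t xs)                                     ∎
  where
  open EquationalReasoning
  halts⇔ : ∀ u → ⟦ ∃ᶠ (app e (var zero ∷ weaken₂ t ∷ var (suc zero) ∷ []) ≈ lit 0) ⟧ˢ (u ∷ xs) ⇔ Halts e (eval t xs ∷ u ∷ [])
  halts⇔ u = ∃-⇔ λ y → ≡-⇔ (cong (λ v → ⟦ e ⟧ (y ∷ v ∷ u ∷ [])) (weaken₂-correct t y u xs)) refl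
  within⇔ : ∀ u → ⟦ ∀∈ᵖ (var zero) χ ⟧ᵖ Y (u ∷ xs) ⇔ (D u ⊆ X)
  within⇔ u = ⇔-trans (∀∈ᵖ-correct (var zero) χ (u ∷ xs)) (∀-⇔ λ z → ∀-⇔ λ _ → χ⇔X z u xs)

member : ∀ {n} {A Y} → A ≤e Y → Term n → Pos n
member A≤Y t = reduce (proj₁ A≤Y) t (oracle (var zero))

member-correct : ∀ {n} {A Y} (A≤Y : A ≤e Y) (t : Term n) xs → ⟦ member A≤Y t ⟧ᵖ Y xs ⇔ A (eval t xs)
member-correct A≤Y t = reduce-correct A≤Y t (oracle (var zero)) (λ _ _ _ → ⇔-refl)

≤e-trans : ∀ {A X Y} → A ≤e X → X ≤e Y → A ≤e Y
≤e-trans A≤X X≤Y = definable⇒≤e (reduce (proj₁ A≤X) (var zero) (member X≤Y (var zero)))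
  (λ x → ⇔-sym (reduce-correct A≤X (var zero) (member X≤Y (var zero))
                  (λ z u xs → member-correct X≤Y (var zero) (z ∷ u ∷ xs)) (x ∷ [])))

≤e-respects-≐ : ∀ {A B Y} → A ≐ B → A ≤e Y → B ≤e Y
≤e-respects-≐ (A⊆B , B⊆A) (e , A⇔) = e , λ x → ⇔-trans (mk⇔ (B⊆A x) (A⊆B x)) (A⇔ x)

∅ ω : Subset
∅ _ = ⊥
ω _ = ⊤

∅≤e : ∀ {Y} → ∅ ≤e Y
∅≤e = definable⇒≤e ⌜ lit 0 ≈ lit 1 ⌝ λ _ → mk⇔ ⊥-elim 0≢1

ω≤e : ∀ {Y} → ω ≤e Y
ω≤e = definable⇒≤e ⌜ lit 0 ≈ lit 0 ⌝ λ _ → mk⇔ (λ _ → refl) (λ _ → tt)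

singleton≤e : ∀ {Y} k → (_≡ k) ≤e Y
singleton≤e k = definable⇒≤e ⌜ var zero ≈ lit k ⌝ λ _ → ⇔-refl

-- Uniform reducibility of an iterated sequence

Graph : (ℕ → Subset) → Subset
Graph V z = ∃ λ n → ∃ λ j → z ≡ ⟨ n , j ⟩ × V n j

module Iteration {Y S : Subset} {V : ℕ → Subset}
                 (V₀≤Y : V 0 ≤e Y) (S≤Y : S ≤e Y) (step : ∀ m → (S · V m) ≐ V (suc m)) where

  -- A closed code c is a finite derivation: every pair ⟨m , i⟩ in c is justified by
  -- V 0 (if m = 0) or by an instance of  step  whose premises are already in c.
  Justified : ℕ → ℕ → Set
  Justified c z = ∃ λ m → ∃ λ i → z ≡ ⟨ m , i ⟩ ×
    ((m ≡ 0 × V 0 i) ⊎ ∃ λ m′ → m ≡ 1 + m′ × ∃ λ u → S ⟨ i , u ⟩ × (∀ i′ → D u i′ → D c ⟨ m′ , i′ ⟩))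

  Closed : ℕ → Set
  Closed c = ∀ z → D c z → Justified c z

  justified-mono : ∀ {c c′ z} → D c ⊆ D c′ → Justified c z → Justified c′ z
  justified-mono c⊆c′ (m , i , eq , inj₁ base) = m , i , eq , inj₁ base
  justified-mono c⊆c′ (m , i , eq , inj₂ (m′ , m≡ , u , s , prem)) =
    m , i , eq , inj₂ (m′ , m≡ , u , s , λ i′ d → c⊆c′ ⟨ m′ , i′ ⟩ (prem i′ d))

  closed-sound : ∀ {c} → Closed c → ∀ m i → D c ⟨ m , i ⟩ → V m i
  closed-sound {c} closed m i d with closed _ d
  ... | m₀ , i₀ , eq , just with pair-injective {m} {i} {m₀} {i₀} eq
  closed-sound closed m i d | _ , _ , _ , inj₁ (refl , v) | refl , refl = v
  closed-sound closed m i d | _ , _ , _ , inj₂ (m′ , refl , u , s , prem) | refl , refl =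
    proj₁ (step m′) i (u , s , λ i′ d′ → closed-sound closed m′ i′ (prem i′ d′))

  mutual
    closed-complete : ∀ n j → V n j → ∃ λ c → D c ⟨ n , j ⟩ × Closed c
    closed-complete zero j v =
      let (c , c-codes) = singleton-code ⟨ 0 , j ⟩
      in c , from (c-codes _) refl , λ z d → 0 , j , to (c-codes z) d , inj₁ (refl , v)
    closed-complete (suc n) j v =
      let (u , s , u⊆Vn) = proj₂ (step n) j v
          (w , covers , from-w) = collect-codes u (λ i c → Closed c × (D u i → D c ⟨ n , i ⟩))
                                                (λ i _ → premise-derivation n u u⊆Vn i)
          (top , top-codes) = singleton-code ⟨ suc n , j ⟩
          (c , c-codes) = ∪-code w top
          w⊆c : D w ⊆ D c
          w⊆c z d = from (c-codes z) (inj₁ d)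
          premises : ∀ i′ → D u i′ → D c ⟨ n , i′ ⟩
          premises i′ d = let (cᵢ , (_ , in-cᵢ) , cᵢ⊆w) = covers i′ (D-bounded u i′ d)
                          in w⊆c ⟨ n , i′ ⟩ (cᵢ⊆w ⟨ n , i′ ⟩ (in-cᵢ d))
      in c , from (c-codes ⟨ suc n , j ⟩) (inj₂ (from (top-codes ⟨ suc n , j ⟩) refl)) , λ z d → case to (c-codes z) d of λ
        { (inj₁ d-w) → let (_ , _ , cᵢ , (closedᵢ , _) , cᵢ⊆w , d-cᵢ) = from-w z d-w
                       in justified-mono (λ y e → w⊆c y (cᵢ⊆w y e)) (closedᵢ z d-cᵢ)
        ; (inj₂ d-top) → suc n , j , to (top-codes z) d-top , inj₂ (n , refl , u , s , premises) }

    premise-derivation : ∀ n u → D u ⊆ V n → ∀ i → ∃ λ c → Closed c × (D u i → D c ⟨ n , i ⟩)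
    premise-derivation n u u⊆Vn i with D? u i
    ... | yes d = let (c , in-c , closed) = closed-complete n i (u⊆Vn i d) in c , closed , λ _ → in-c
    ... | no ¬d = 0 , (λ z d₀ → ⊥-elim (D-0-empty z d₀)) , λ d → ⊥-elim (¬d d)

  Graph⇔closed : ∀ z → Graph V z ⇔ (∃ λ c → D c z × Closed c)
  Graph⇔closed z = mk⇔
    (λ { (n , j , refl , v) → closed-complete n j v })
    (λ (c , d , closed) → let (m , i , eq , _) = closed z d in m , i , eq , closed-sound closed m i (subst (D c) eq d))

  justifiedᶠ : ∀ {n} → Pos (suc (suc n))
  justifiedᶠ = ∃ᶠ (∃ᶠ (⌜ var (# 2) ≈ ⟨ var (# 1) , var (# 0) ⟩ᵗ ⌝ ∧
    ((⌜ var (# 1) ≈ lit 0 ⌝ ∧ member V₀≤Y (var (# 0))) ∨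
     ∃ᶠ (⌜ var (# 2) ≈ lit 1 +ᵗ var (# 0) ⌝ ∧
         ∃ᶠ (member S≤Y ⟨ var (# 2) , var (# 0) ⟩ᵗ ∧
             ∀∈ᵖ (var (# 0)) ⌜ bitᵗ (var (# 6)) ⟨ var (# 2) , var (# 0) ⟩ᵗ ≈ lit 1 ⌝)))))

  justifiedᶠ-correct : ∀ {n} z c (xs : Vec ℕ n) → ⟦ justifiedᶠ ⟧ᵖ Y (z ∷ c ∷ xs) ⇔ Justified c z
  justifiedᶠ-correct z c xs = ∃-⇔ λ m → ∃-⇔ λ i → ⇔-refl ×-⇔
    ((⇔-refl ×-⇔ member-correct V₀≤Y (var (# 0)) (i ∷ m ∷ z ∷ c ∷ xs)) ⊎-⇔
     ∃-⇔ λ m′ → ⇔-refl ×-⇔ ∃-⇔ λ u →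
       member-correct S≤Y ⟨ var (# 2) , var (# 0) ⟩ᵗ (u ∷ m′ ∷ i ∷ m ∷ z ∷ c ∷ xs) ×-⇔
       ∀∈ᵖ-correct {Y = Y} (var (# 0)) ⌜ bitᵗ (var (# 6)) ⟨ var (# 2) , var (# 0) ⟩ᵗ ≈ lit 1 ⌝
                   (u ∷ m′ ∷ i ∷ m ∷ z ∷ c ∷ xs))

  Graph≤e : Graph V ≤e Y
  Graph≤e = definable⇒≤e (∃ᶠ (⌜ bitᵗ (var (# 0)) (var (# 1)) ≈ lit 1 ⌝ ∧ ∀∈ᵖ (var (# 0)) justifiedᶠ)) λ z →
    ⇔-trans (Graph⇔closed z) (∃-⇔ λ c → ⇔-refl ×-⇔
      ⇔-sym (⇔-trans (∀∈ᵖ-correct (var (# 0)) justifiedᶠ (c ∷ z ∷ []))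
                     (∀-⇔ λ z′ → ∀-⇔ λ _ → justifiedᶠ-correct z′ c (z ∷ []))))

Graph-⟨⟩ : ∀ {V : ℕ → Subset} n j → Graph V ⟨ n , j ⟩ ⇔ V n j
Graph-⟨⟩ {V} n j = mk⇔
  (λ (n′ , j′ , eq , v) → let (n≡n′ , j≡j′) = pair-injective eq in subst₂ V (sym n≡n′) (sym j≡j′) v)
  (λ v → n , j , refl , v)

slice≤e : ∀ {Q Y} {V : ℕ → Subset} k → Q ≤e Y → Graph V ≤e Y → (λ n → (Q · V n) k) ≤e Y
slice≤e {Y = Y} {V} k Q≤Y G≤Y =
  definable⇒≤e (∃ᶠ (member Q≤Y ⟨ lit k , var (# 0) ⟩ᵗ ∧
                    ∀∈ᵖ (var (# 0)) (member G≤Y ⟨ var (# 2) , var (# 0) ⟩ᵗ))) λ n →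
    ∃-⇔ λ u → ⇔-sym (member-correct Q≤Y ⟨ lit k , var (# 0) ⟩ᵗ (u ∷ n ∷ []) ×-⇔
      ⇔-trans (∀∈ᵖ-correct {Y = Y} (var (# 0)) (member G≤Y ⟨ var (# 2) , var (# 0) ⟩ᵗ) (u ∷ n ∷ []))
              (∀-⇔ λ i → ∀-⇔ λ _ →
                ⇔-trans (member-correct G≤Y ⟨ var (# 2) , var (# 0) ⟩ᵗ (i ∷ u ∷ n ∷ [])) (Graph-⟨⟩ n i)))

-- Sets in 𝒢 X on which an embedding is probed

select : Subset → Subset → Subset
select A B z = (∃ λ m → z ≡ ⟨ m , 0 ⟩ × A m) ⊎ (∃ λ m → z ≡ ⟨ m , 1 ⟩ × B m)

select≤e : ∀ {A B X} → A ≤e X → B ≤e X → select A B ≤e X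
select≤e {X = X} A≤X B≤X =
  definable⇒≤e (∃ᶠ (⌜ var (# 1) ≈ ⟨ var (# 0) , lit 0 ⟩ᵗ ⌝ ∧ member A≤X (var (# 0))) ∨
                ∃ᶠ (⌜ var (# 1) ≈ ⟨ var (# 0) , lit 1 ⟩ᵗ ⌝ ∧ member B≤X (var (# 0)))) λ z →
    ⇔-sym ((∃-⇔ λ m → ⇔-refl ×-⇔ member-correct A≤X (var (# 0)) (m ∷ z ∷ [])) ⊎-⇔
           (∃-⇔ λ m → ⇔-refl ×-⇔ member-correct B≤X (var (# 0)) (m ∷ z ∷ [])))

select·∅ : ∀ A B → (select A B · ∅) ≐ A
select·∅ A B = sound , λ n a → 0 , inj₁ (n , refl , a) , λ z d → ⊥-elim (D-0-empty z d)
  where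
  sound : (select A B · ∅) ⊆ A
  sound n (u , inj₁ (m , eq , a) , _) = subst A (sym (proj₁ (pair-injective eq))) a
  sound n (u , inj₂ (m , eq , _) , u⊆∅) =
    ⊥-elim (u⊆∅ 0 (subst (λ v → D v 0) (sym (proj₂ (pair-injective {n} {u} {m} {1} eq))) refl))

select·ω : ∀ {A B} → A ⊆ B → (select A B · ω) ≐ B
select·ω {A} {B} A⊆B = sound , λ n b → 1 , inj₂ (n , refl , b) , λ _ _ → tt
  where
  sound : (select A B · ω) ⊆ B
  sound n (u , inj₁ (m , eq , a) , _) = A⊆B n (subst A (sym (proj₁ (pair-injective eq))) a)
  sound n (u , inj₂ (m , eq , b) , _) = subst B (sym (proj₁ (pair-injective eq))) b

membershipTest : Subset → Subset
membershipTest X z = ∃ λ m → ∃ λ u → ∃ λ c → (z ≡ ⟨ m , u ⟩ × D u c) × X c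

membershipTest≤e : ∀ X → membershipTest X ≤e X
membershipTest≤e X = definable⇒≤e
  (∃ᶠ (∃ᶠ (∃ᶠ (⌜ var (# 3) ≈ ⟨ var (# 2) , var (# 1) ⟩ᵗ ∧ bitᵗ (var (# 1)) (var (# 0)) ≈ lit 1 ⌝ ∧
               oracle (var (# 0))))))
  λ _ → ⇔-refl

membershipTest-∈ : ∀ {X n} → X n → (membershipTest X · (_≡ n)) ≐ ω
membershipTest-∈ {n = n} x = (λ _ _ → tt) , λ m _ →
  let (w , w-codes) = singleton-code n
  in w , (m , w , n , (refl , from (w-codes n) refl) , x) , λ z d → to (w-codes z) d

membershipTest-∉ : ∀ {X n} → ¬ X n → (membershipTest X · (_≡ n)) ≐ ∅
membershipTest-∉ {X} {n} ¬x = sound , λ _ ()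
  where
  sound : (membershipTest X · (_≡ n)) ⊆ ∅
  sound z (u , (m , u′ , c , (eq , d) , xc) , u⊆n) =
    ¬x (subst X (u⊆n c (subst (λ v → D v c) (sym (proj₂ (pair-injective {z} {u} {m} {u′} eq))) d)) xc)

successor : Subset
successor z = ∃ λ m → ∃ λ u → z ≡ ⟨ 1 + m , u ⟩ × D u m

successor≤e : ∀ {X} → successor ≤e X
successor≤e = definable⇒≤e
  ⌜ ∃ᶠ (∃ᶠ (var (# 2) ≈ ⟨ lit 1 +ᵗ var (# 1) , var (# 0) ⟩ᵗ ∧ bitᵗ (var (# 0)) (var (# 1)) ≈ lit 1)) ⌝
  λ _ → ⇔-refl

successor·singleton : ∀ n → (successor · (_≡ n)) ≐ (_≡ suc n)
successor·singleton n = sound , λ { _ refl →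
  let (w , w-codes) = singleton-code n in w , (n , w , refl , from (w-codes n) refl) , λ z d → to (w-codes z) d }
  where
  sound : (successor · (_≡ n)) ⊆ (_≡ suc n)
  sound j (u , (m , u′ , eq , d) , u⊆n) =
    let (j≡1+m , u≡u′) = pair-injective eq
    in trans j≡1+m (cong suc (u⊆n m (subst (λ v → D v m) (sym u≡u′) d)))

¬⊆⇒separating : ExcludedMiddle 0ℓ → ∀ {A B : Subset} → ¬ (A ⊆ B) → ∃ λ k → A k × ¬ B k
¬⊆⇒separating lem {A} {B} A⊈B = case lem {∃ λ k → A k × ¬ B k} of λ
  { (yes separated) → separated
  ; (no ¬separated) → ⊥-elim (A⊈B λ k a → case lem {B k} of λ
      { (yes b) → b
      ; (no ¬b) → ⊥-elim (¬separated (k , a , ¬b)) }) }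

≐-sym : ∀ {A B : Subset} → A ≐ B → B ≐ A
≐-sym (A⊆B , B⊆A) = B⊆A , A⊆B

≐-trans : ∀ {A B E : Subset} → A ≐ B → B ≐ E → A ≐ E
≐-trans (A⊆B , B⊆A) (B⊆E , E⊆B) = (λ n a → B⊆E n (A⊆B n a)) , (λ n e → B⊆A n (E⊆B n e))

·-monoʳ : ∀ {A B B′ : Subset} → B ⊆ B′ → (A · B) ⊆ (A · B′)
·-monoʳ B⊆B′ n (u , a , u⊆B) = u , a , λ z d → B⊆B′ z (u⊆B z d)

module _ {X Y : Subset} {f : Subset → Subset} (emb : IsEmbedding X Y f) where
  open IsEmbedding emb

  embed-· : ∀ {A B E} → 𝒢 X A → 𝒢 X B → 𝒢 X E → (A · B) ≐ E → (f A · f B) ≐ f E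
  embed-· {A} {B} {E} gA gB gE AB≐E =
    ≐-trans (preserves A B gA gB) (wellDef (A · B) E (≤e-respects-≐ (≐-sym AB≐E) gE) gE AB≐E)

  -- f B = f E · f ω ⊆ f E · f ∅ = f A  for  E = select A B.
  ω⊆∅⇒order-reversing : f ω ⊆ f ∅ → OrderReversing X f
  ω⊆∅⇒order-reversing fω⊆f∅ A B gA gB A⊆B n fBn =
    let gE = select≤e gA gB
    in proj₁ (embed-· gE ∅≤e gA (select·∅ A B)) n
         (·-monoʳ {f (select A B)} fω⊆f∅ n (proj₂ (embed-· gE ω≤e gB (select·ω A⊆B)) n fBn))

  iterate-f-successor : ∀ m → (f successor · f (_≡ m)) ≐ f (_≡ suc m)
  iterate-f-successor m = embed-· successor≤e (singleton≤e m) (singleton≤e (suc m)) (successor·singleton m)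

  -- membershipTest X · {n} is ω or ∅ according as n ∈ X, and k separates f ω from f ∅.
  membership-via-f : ExcludedMiddle 0ℓ → ∀ {k} → f ω k → ¬ f ∅ k →
                     X ≐ (λ n → (f (membershipTest X) · f (_≡ n)) k)
  membership-via-f lem {k} k∈fω k∉f∅ =
    (λ n x → proj₂ (embed-· gT (singleton≤e n) ω≤e (membershipTest-∈ x)) k k∈fω) ,
    (λ n k∈ → case lem {X n} of λ
      { (yes x) → x
      ; (no ¬x) → ⊥-elim (k∉f∅ (proj₁ (embed-· gT (singleton≤e n) ∅≤e (membershipTest-∉ ¬x)) k k∈)) })
    where gT = membershipTest≤e X

  embedding⇒≤e : ExcludedMiddle 0ℓ → ¬ OrderReversing X f → X ≤e Y
  embedding⇒≤e lem ¬reversing =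
    let (k , k∈fω , k∉f∅) = ¬⊆⇒separating lem (¬reversing ∘ ω⊆∅⇒order-reversing)
        graph≤Y = Iteration.Graph≤e (maps _ (singleton≤e 0)) (maps _ successor≤e) iterate-f-successor
    in ≤e-respects-≐ (≐-sym (membership-via-f lem k∈fω k∉f∅)) (slice≤e k (maps _ (membershipTest≤e X)) graph≤Y)

≤e⇒identity-embedding : ∀ {X Y} → X ≤e Y → IsEmbedding X Y id
≤e⇒identity-embedding X≤Y = record
  { maps = λ A A≤X → ≤e-trans A≤X X≤Y
  ; wellDef = λ A B _ _ A≐B → A≐B
  ; injective = λ A B _ _ A≐B → A≐B
  ; preserves = λ A B _ _ → (λ _ ab → ab) , (λ _ ab → ab)
  }

identity-not-order-reversing : ∀ {X} → ¬ OrderReversing X id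
identity-not-order-reversing reversing = reversing ∅ ω ∅≤e ω≤e (λ _ ()) 0 tt

theorem7p10 : (lem : ∀ {ℓ} → ExcludedMiddle ℓ) → (X Y : Subset) →
    (Σ (Subset → Subset) λ f → IsEmbedding X Y f × ¬ OrderReversing X f) ⇔ (X ≤e Y)
theorem7p10 lem X Y = mk⇔
  (λ (f , emb , ¬reversing) → embedding⇒≤e emb lem ¬reversing)
  (λ X≤Y → id , ≤e⇒identity-embedding X≤Y , identity-not-order-reversing)
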